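{- Let $t_1, t_2$ be rational numbers and define \begin{align*} P &= t_1^4t_2^4 + 3t_1^4t_2^2 + 4t_1^3t_2^3 + 3t_1^2t_2^4 + t_1^4+ 2t_1^3t_2 + 3t_1^2t_2^2 + 2t_1t_2^3 + t_2^4,\\ Q &= 4t_1^6t_2^6 + 5t_1^6t_2^4 - 2t_1^5t_2^5+ 5t_1^4t_2^6 + 3t_1^6t_2^2 - 2t_1^5t_2^3 + 2t_1^4t_2^4 - 2t_1^3t_2^5 + 3t_1^2t_2^6 + t_1^6 - 2t_1^3t_2^3 + t_2^6,\\ S &= t_1^2t_2^2 + t_1^2 + t_1t_2 + t_2^2,\\ T &= 3t_1^4t_2^4 + 3t_1^4t_2^2 + 3t_1^2t_2^4 + t_1^4+ t_1^2t_2^2 + t_2^4, \end{align*} and \begin{align*} a_1 &= t_1(t_2^2+1)PQ,\\ b_1 &= 2t_1t_2^3(t_1^2 + 1)^2(t_2^2 + 1)\,S\,(3t_1^5t_2^4 + t_1^4t_2^5 + 3t_1^5t_2^2 + t_1^4t_2^3 + t_1^3t_2^4 - t_1^2t_2^5 + t_1^5 + t_1^4t_2 + t_1^3t_2^2 - t_1^2t_2^3 - t_1t_2^4 - t_2^5),\\ c_1 &= t_1(t_1 + t_2)(t_2^2 + 1)\,T\,(2t_1^6t_2^5 + 2t_1^6t_2^3 - t_1^5t_2^4 + 3t_1^4t_2^5 - 3t_1^5t_2^2+ t_1^4t_2^3 + t_1^3t_2^4 + 3t_1^2t_2^5 - t_1^5 - t_1^4t_2 - t_1^3t_2^2 + t_1^2t_2^3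 + t_1t_2^4 + t_2^5),\\ a_2 &= t_2(t_1^2+1)PQ,\\ b_2 &= 2t_1^3t_2(t_1^2 + 1)(t_2^2 + 1)^2\,S\,(t_1^5t_2^4 + 3t_1^4t_2^5 - t_1^5t_2^2 + t_1^4t_2^3 + t_1^3t_2^4 + 3t_1^2t_2^5 - t_1^5 - t_1^4t_2 - t_1^3t_2^2 + t_1^2t_2^3 + t_1t_2^4 + t_2^5),\\ c_2 &= t_2(t_1 + t_2)(t_1^2 + 1)\,T\,(2t_1^5t_2^6 + 3t_1^5t_2^4 - t_1^4t_2^5 + 2t_1^3t_2^6 + 3t_1^5t_2^2 + t_1^4t_2^3 + t_1^3t_2^4 - 3t_1^2t_2^5 + t_1^5 + t_1^4t_2 + t_1^3t_2^2 - t_1^2t_2^3 - t_1t_2^4 - t_2^5). \end{align*} Suppose $a_1,b_1,c_1$ are the side lengths of a nondegenerate triangle and $a_2,b_2,c_2$ are the side lengths of a nondegenerate triangle (all positive, strict triangle inequalities). Then both triangles are rational triangles (rational sides and rational area), they have the same circumradius, equal to $(t_1^2+1)(t_2^2+1)PQ/4$, and the same perimeter, equal to $4t_1^3t_2^3(t_1+t_2)(t_1^2+1)(t_2^2+1)\,S\,T$.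
   Context: A rational triangle is a triangle whose side lengths and area are rational numbers. For a triangle with sides $a,b,c$, the area is $\sqrt{(a+b+c)(a+b-c)(b+c-a)(c+a-b)}/4$ and the circumradius is $abc/\sqrt{(a+b+c)(a+b-c)(b+c-a)(c+a-b)}$. -}

module Defs where

open import Data.Nat using (ℕ; zero; suc)
open import Data.Integer using (+_)
open import Data.Rational using (ℚ; _+_; _*_; _-_; _<_; _≤_; 0ℚ; 1ℚ; _/_)
open import Data.Product using (_×_; ∃)
open import Relation.Binary.PropositionalEquality using (_≡_)

infixr 8 _^_
_^_ : ℚ → ℕ → ℚ
x ^ zero = 1ℚ
x ^ suc n = x * (x ^ n)

k : ℕ → ℚ
k n = + n / 1

heron : ℚ → ℚ → ℚ → ℚ
heron a b c = (a + b + c) * (a + b - c) * (b + c - a) * (c + a - b)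

IsTriangle : ℚ → ℚ → ℚ → Set
IsTriangle a b c =
  (0ℚ < a) × (0ℚ < b) × (0ℚ < c) × (c < a + b) × (a < b + c) × (b < c + a)

-- K is the area of the triangle with sides a b c: K ≥ 0 and K = sqrt(heron)/4
IsArea : ℚ → ℚ → ℚ → ℚ → Set
IsArea a b c K = (0ℚ ≤ K) × ((k 4 * K) * (k 4 * K) ≡ heron a b c)

-- Rational triangle (sides are already rational as elements of ℚ):
-- the area is rational.
IsRationalTriangle : ℚ → ℚ → ℚ → Set
IsRationalTriangle a b c = ∃ λ K → IsArea a b c K

-- R is the circumradius abc / sqrt(heron), given that the area K is rational
-- (sqrt(heron) = 4K); stated multiplicatively: abc = R * (4K).
HasCircumradius : ℚ → ℚ → ℚ → ℚ → Set
HasCircumradius a b c R = ∃ λ K → IsArea a b c K × (a * b * c ≡ R * (k 4 * K))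

perimeter : ℚ → ℚ → ℚ → ℚ
perimeter a b c = a + b + c

module _ (t₁ t₂ : ℚ) where
  P Q S T : ℚ
  P = t₁ ^ 4 * t₂ ^ 4 + k 3 * t₁ ^ 4 * t₂ ^ 2 + k 4 * t₁ ^ 3 * t₂ ^ 3 + k 3 * t₁ ^ 2 * t₂ ^ 4
      + t₁ ^ 4 + k 2 * t₁ ^ 3 * t₂ + k 3 * t₁ ^ 2 * t₂ ^ 2 + k 2 * t₁ * t₂ ^ 3 + t₂ ^ 4
  Q = k 4 * t₁ ^ 6 * t₂ ^ 6 + k 5 * t₁ ^ 6 * t₂ ^ 4 - k 2 * t₁ ^ 5 * t₂ ^ 5 + k 5 * t₁ ^ 4 * t₂ ^ 6
      + k 3 * t₁ ^ 6 * t₂ ^ 2 - k 2 * t₁ ^ 5 * t₂ ^ 3 + k 2 * t₁ ^ 4 * t₂ ^ 4 - k 2 * t₁ ^ 3 * t₂ ^ 5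
      + k 3 * t₁ ^ 2 * t₂ ^ 6 + t₁ ^ 6 - k 2 * t₁ ^ 3 * t₂ ^ 3 + t₂ ^ 6
  S = t₁ ^ 2 * t₂ ^ 2 + t₁ ^ 2 + t₁ * t₂ + t₂ ^ 2
  T = k 3 * t₁ ^ 4 * t₂ ^ 4 + k 3 * t₁ ^ 4 * t₂ ^ 2 + k 3 * t₁ ^ 2 * t₂ ^ 4 + t₁ ^ 4
      + t₁ ^ 2 * t₂ ^ 2 + t₂ ^ 4

  a₁ b₁ c₁ a₂ b₂ c₂ : ℚ
  a₁ = t₁ * (t₂ ^ 2 + 1ℚ) * P * Q
  b₁ = k 2 * t₁ * t₂ ^ 3 * (t₁ ^ 2 + 1ℚ) ^ 2 * (t₂ ^ 2 + 1ℚ) * S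
       * (k 3 * t₁ ^ 5 * t₂ ^ 4 + t₁ ^ 4 * t₂ ^ 5 + k 3 * t₁ ^ 5 * t₂ ^ 2 + t₁ ^ 4 * t₂ ^ 3
          + t₁ ^ 3 * t₂ ^ 4 - t₁ ^ 2 * t₂ ^ 5 + t₁ ^ 5 + t₁ ^ 4 * t₂ + t₁ ^ 3 * t₂ ^ 2
          - t₁ ^ 2 * t₂ ^ 3 - t₁ * t₂ ^ 4 - t₂ ^ 5)
  c₁ = t₁ * (t₁ + t₂) * (t₂ ^ 2 + 1ℚ) * T
       * (k 2 * t₁ ^ 6 * t₂ ^ 5 + k 2 * t₁ ^ 6 * t₂ ^ 3 - t₁ ^ 5 * t₂ ^ 4 + k 3 * t₁ ^ 4 * t₂ ^ 5
          - k 3 * t₁ ^ 5 * t₂ ^ 2 + t₁ ^ 4 * t₂ ^ 3 + t₁ ^ 3 * t₂ ^ 4 + k 3 * t₁ ^ 2 * t₂ ^ 5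
          - t₁ ^ 5 - t₁ ^ 4 * t₂ - t₁ ^ 3 * t₂ ^ 2 + t₁ ^ 2 * t₂ ^ 3 + t₁ * t₂ ^ 4 + t₂ ^ 5)
  a₂ = t₂ * (t₁ ^ 2 + 1ℚ) * P * Q
  b₂ = k 2 * t₁ ^ 3 * t₂ * (t₁ ^ 2 + 1ℚ) * (t₂ ^ 2 + 1ℚ) ^ 2 * S
       * (t₁ ^ 5 * t₂ ^ 4 + k 3 * t₁ ^ 4 * t₂ ^ 5 - t₁ ^ 5 * t₂ ^ 2 + t₁ ^ 4 * t₂ ^ 3
          + t₁ ^ 3 * t₂ ^ 4 + k 3 * t₁ ^ 2 * t₂ ^ 5 - t₁ ^ 5 - t₁ ^ 4 * t₂ - t₁ ^ 3 * t₂ ^ 2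
          + t₁ ^ 2 * t₂ ^ 3 + t₁ * t₂ ^ 4 + t₂ ^ 5)
  c₂ = t₂ * (t₁ + t₂) * (t₁ ^ 2 + 1ℚ) * T
       * (k 2 * t₁ ^ 5 * t₂ ^ 6 + k 3 * t₁ ^ 5 * t₂ ^ 4 - t₁ ^ 4 * t₂ ^ 5 + k 2 * t₁ ^ 3 * t₂ ^ 6
          + k 3 * t₁ ^ 5 * t₂ ^ 2 + t₁ ^ 4 * t₂ ^ 3 + t₁ ^ 3 * t₂ ^ 4 - k 3 * t₁ ^ 2 * t₂ ^ 5
          + t₁ ^ 5 + t₁ ^ 4 * t₂ + t₁ ^ 3 * t₂ ^ 2 - t₁ ^ 2 * t₂ ^ 3 - t₁ * t₂ ^ 4 - t₂ ^ 5)

  R₀ perim₀ : ℚ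
  R₀ = (t₁ ^ 2 + 1ℚ) * (t₂ ^ 2 + 1ℚ) * P * Q * (+ 1 / 4)
  perim₀ = k 4 * t₁ ^ 3 * t₂ ^ 3 * (t₁ + t₂) * (t₁ ^ 2 + 1ℚ) * (t₂ ^ 2 + 1ℚ) * S * T

{-# OPTIONS --safe #-}
module Submission where

-- Put e₁ = t₁² + 1, e₂ = t₂² + 1, s = t₁ + t₂, and let U, V be the last factors of b₁ and c₁.
-- The second triangle is the first one with t₁ and t₂ exchanged, and the first one factors:
--   a₁ + b₁ + c₁ = 4 t₁³ t₂³ s e₁ e₂ S T,   a₁ + b₁ − c₁ = 2 t₁ e₂ s T U,
--   b₁ + c₁ − a₁ = 2 t₁ e₂ U V,              c₁ + a₁ − b₁ = 4 t₁ t₂³ e₁ e₂ S V.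
-- So Heron's product is (4K)² with K = 2 t₁³ t₂³ s e₁ e₂² S T U V, and a₁ b₁ c₁ = R₀ · 4K with
-- a₁ = t₁ e₂ P Q. For the sign of K: K e₁ = t₁ b₁ c₁, and t₁ > 0 because
-- e₁ e₂ (b₁ + c₁ − a₁)(c₁ + a₁ − b₁) = t₁ b₁ (2 e₂ V)².

open import Data.Nat as ℕ using (ℕ)
open import Data.Integer using (ℤ; +_)
import Data.Rational as ℚ
open import Data.Rational.Solver using (module +-*-Solver)
open +-*-Solver using (Polynomial; con; _:+_; _:*_; :-_; solve; _:=_)
open import Data.Product using (_×_; _,_; proj₁; map₂)
import Defs

-- The definitions of Defs over an arbitrary carrier. At ring-solver expressions, ⟦_⟧ of each
-- formula computes to its namesake in Defs, so the solver's equations apply to Defs verbatim.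
module Formulas {A : Set} (add mul : A → A → A) (neg : A → A) (⌜_⌝ : ℚ.ℚ → A) where
  infixl 6 _+_ _-_
  infixl 7 _*_ _/_
  infixr 8 _^_

  _+_ _-_ _*_ : A → A → A
  _+_ = add
  x - y = add x (neg y)
  _*_ = mul

  1ℚ : A
  1ℚ = ⌜ ℚ.1ℚ ⌝

  _^_ : A → ℕ → A
  x ^ ℕ.zero = 1ℚ
  x ^ ℕ.suc n = x * (x ^ n)

  k : ℕ → A
  k n = ⌜ Defs.k n ⌝

  _/_ : ℤ → (d : ℕ) → .{{ℕ.NonZero d}} → A
  m / d = ⌜ m ℚ./ d ⌝

  module Parametrised (t₁ t₂ : A) where
    P Q S T : A
    P = t₁ ^ 4 * t₂ ^ 4 + k 3 * t₁ ^ 4 * t₂ ^ 2 + k 4 * t₁ ^ 3 * t₂ ^ 3 + k 3 * t₁ ^ 2 * t₂ ^ 4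
        + t₁ ^ 4 + k 2 * t₁ ^ 3 * t₂ + k 3 * t₁ ^ 2 * t₂ ^ 2 + k 2 * t₁ * t₂ ^ 3 + t₂ ^ 4
    Q = k 4 * t₁ ^ 6 * t₂ ^ 6 + k 5 * t₁ ^ 6 * t₂ ^ 4 - k 2 * t₁ ^ 5 * t₂ ^ 5 + k 5 * t₁ ^ 4 * t₂ ^ 6
        + k 3 * t₁ ^ 6 * t₂ ^ 2 - k 2 * t₁ ^ 5 * t₂ ^ 3 + k 2 * t₁ ^ 4 * t₂ ^ 4 - k 2 * t₁ ^ 3 * t₂ ^ 5
        + k 3 * t₁ ^ 2 * t₂ ^ 6 + t₁ ^ 6 - k 2 * t₁ ^ 3 * t₂ ^ 3 + t₂ ^ 6
    S = t₁ ^ 2 * t₂ ^ 2 + t₁ ^ 2 + t₁ * t₂ + t₂ ^ 2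
    T = k 3 * t₁ ^ 4 * t₂ ^ 4 + k 3 * t₁ ^ 4 * t₂ ^ 2 + k 3 * t₁ ^ 2 * t₂ ^ 4 + t₁ ^ 4
        + t₁ ^ 2 * t₂ ^ 2 + t₂ ^ 4

    a₁ b₁ c₁ a₂ b₂ c₂ : A
    a₁ = t₁ * (t₂ ^ 2 + 1ℚ) * P * Q
    b₁ = k 2 * t₁ * t₂ ^ 3 * (t₁ ^ 2 + 1ℚ) ^ 2 * (t₂ ^ 2 + 1ℚ) * S
         * (k 3 * t₁ ^ 5 * t₂ ^ 4 + t₁ ^ 4 * t₂ ^ 5 + k 3 * t₁ ^ 5 * t₂ ^ 2 + t₁ ^ 4 * t₂ ^ 3
            + t₁ ^ 3 * t₂ ^ 4 - t₁ ^ 2 * t₂ ^ 5 + t₁ ^ 5 + t₁ ^ 4 * t₂ + t₁ ^ 3 * t₂ ^ 2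
            - t₁ ^ 2 * t₂ ^ 3 - t₁ * t₂ ^ 4 - t₂ ^ 5)
    c₁ = t₁ * (t₁ + t₂) * (t₂ ^ 2 + 1ℚ) * T
         * (k 2 * t₁ ^ 6 * t₂ ^ 5 + k 2 * t₁ ^ 6 * t₂ ^ 3 - t₁ ^ 5 * t₂ ^ 4 + k 3 * t₁ ^ 4 * t₂ ^ 5
            - k 3 * t₁ ^ 5 * t₂ ^ 2 + t₁ ^ 4 * t₂ ^ 3 + t₁ ^ 3 * t₂ ^ 4 + k 3 * t₁ ^ 2 * t₂ ^ 5
            - t₁ ^ 5 - t₁ ^ 4 * t₂ - t₁ ^ 3 * t₂ ^ 2 + t₁ ^ 2 * t₂ ^ 3 + t₁ * t₂ ^ 4 + t₂ ^ 5)
    a₂ = t₂ * (t₁ ^ 2 + 1ℚ) * P * Q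
    b₂ = k 2 * t₁ ^ 3 * t₂ * (t₁ ^ 2 + 1ℚ) * (t₂ ^ 2 + 1ℚ) ^ 2 * S
         * (t₁ ^ 5 * t₂ ^ 4 + k 3 * t₁ ^ 4 * t₂ ^ 5 - t₁ ^ 5 * t₂ ^ 2 + t₁ ^ 4 * t₂ ^ 3
            + t₁ ^ 3 * t₂ ^ 4 + k 3 * t₁ ^ 2 * t₂ ^ 5 - t₁ ^ 5 - t₁ ^ 4 * t₂ - t₁ ^ 3 * t₂ ^ 2
            + t₁ ^ 2 * t₂ ^ 3 + t₁ * t₂ ^ 4 + t₂ ^ 5)
    c₂ = t₂ * (t₁ + t₂) * (t₁ ^ 2 + 1ℚ) * T
         * (k 2 * t₁ ^ 5 * t₂ ^ 6 + k 3 * t₁ ^ 5 * t₂ ^ 4 - t₁ ^ 4 * t₂ ^ 5 + k 2 * t₁ ^ 3 * t₂ ^ 6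
            + k 3 * t₁ ^ 5 * t₂ ^ 2 + t₁ ^ 4 * t₂ ^ 3 + t₁ ^ 3 * t₂ ^ 4 - k 3 * t₁ ^ 2 * t₂ ^ 5
            + t₁ ^ 5 + t₁ ^ 4 * t₂ + t₁ ^ 3 * t₂ ^ 2 - t₁ ^ 2 * t₂ ^ 3 - t₁ * t₂ ^ 4 - t₂ ^ 5)

    R₀ perim₀ : A
    R₀ = (t₁ ^ 2 + 1ℚ) * (t₂ ^ 2 + 1ℚ) * P * Q * (+ 1 / 4)
    perim₀ = k 4 * t₁ ^ 3 * t₂ ^ 3 * (t₁ + t₂) * (t₁ ^ 2 + 1ℚ) * (t₂ ^ 2 + 1ℚ) * S * T

    U₁ V₁ : A
    U₁ = k 3 * t₁ ^ 5 * t₂ ^ 4 + t₁ ^ 4 * t₂ ^ 5 + k 3 * t₁ ^ 5 * t₂ ^ 2 + t₁ ^ 4 * t₂ ^ 3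
         + t₁ ^ 3 * t₂ ^ 4 - t₁ ^ 2 * t₂ ^ 5 + t₁ ^ 5 + t₁ ^ 4 * t₂ + t₁ ^ 3 * t₂ ^ 2
         - t₁ ^ 2 * t₂ ^ 3 - t₁ * t₂ ^ 4 - t₂ ^ 5
    V₁ = k 2 * t₁ ^ 6 * t₂ ^ 5 + k 2 * t₁ ^ 6 * t₂ ^ 3 - t₁ ^ 5 * t₂ ^ 4 + k 3 * t₁ ^ 4 * t₂ ^ 5
         - k 3 * t₁ ^ 5 * t₂ ^ 2 + t₁ ^ 4 * t₂ ^ 3 + t₁ ^ 3 * t₂ ^ 4 + k 3 * t₁ ^ 2 * t₂ ^ 5
         - t₁ ^ 5 - t₁ ^ 4 * t₂ - t₁ ^ 3 * t₂ ^ 2 + t₁ ^ 2 * t₂ ^ 3 + t₁ * t₂ ^ 4 + t₂ ^ 5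

module PolyFormulas {n : ℕ} = Formulas {Polynomial n} _:+_ _:*_ :-_ con

module Equations {n : ℕ} (t₁ t₂ : Polynomial n) where
  open PolyFormulas {n}
  open Parametrised t₁ t₂

  a₂≡a₁-swapped b₂≡b₁-swapped c₂≡c₁-swapped R₀-comm perim₀-comm : Polynomial n × Polynomial n
  a₂≡a₁-swapped = a₂ := Parametrised.a₁ t₂ t₁
  b₂≡b₁-swapped = b₂ := Parametrised.b₁ t₂ t₁
  c₂≡c₁-swapped = c₂ := Parametrised.c₁ t₂ t₁
  R₀-comm = R₀ := Parametrised.R₀ t₂ t₁
  perim₀-comm = perim₀ := Parametrised.perim₀ t₂ t₁

  perimeter₁ a₁+b₁-c₁-factorisation b₁+c₁-a₁-factorisation c₁+a₁-b₁-factorisation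
    : Polynomial n × Polynomial n
  perimeter₁ = a₁ + b₁ + c₁ := perim₀
  a₁+b₁-c₁-factorisation = a₁ + b₁ - c₁ := k 2 * t₁ * (t₂ ^ 2 + 1ℚ) * (t₁ + t₂) * T * U₁
  b₁+c₁-a₁-factorisation = b₁ + c₁ - a₁ := k 2 * t₁ * (t₂ ^ 2 + 1ℚ) * U₁ * V₁
  c₁+a₁-b₁-factorisation = c₁ + a₁ - b₁ := k 4 * t₁ * t₂ ^ 3 * (t₁ ^ 2 + 1ℚ) * (t₂ ^ 2 + 1ℚ) * S * V₁

module MonomialEquations (t₁ t₂ s e₁ e₂ S T U V P Q : Polynomial 11) where
  open PolyFormulas {11}

  a b c R₀ perim₀ area : Polynomial 11
  a = t₁ * e₂ * P * Q
  b = k 2 * t₁ * t₂ ^ 3 * e₁ ^ 2 * e₂ * S * U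
  c = t₁ * s * e₂ * T * V
  R₀ = e₁ * e₂ * P * Q * (+ 1 / 4)
  perim₀ = k 4 * t₁ ^ 3 * t₂ ^ 3 * s * e₁ * e₂ * S * T
  area = k 2 * t₁ ^ 3 * t₂ ^ 3 * s * e₁ * e₂ ^ 2 * S * T * U * V

  a+b-c b+c-a c+a-b : Polynomial 11
  a+b-c = k 2 * t₁ * e₂ * s * T * U
  b+c-a = k 2 * t₁ * e₂ * U * V
  c+a-b = k 4 * t₁ * t₂ ^ 3 * e₁ * e₂ * S * V

  heron₁ a₁b₁c₁≡R₀*4area₁ area₁*[t₁²+1]≡t₁b₁c₁ t₁-sign-identity : Polynomial 11 × Polynomial 11
  heron₁ = perim₀ * a+b-c * b+c-a * c+a-b := (k 4 * area) * (k 4 * area)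
  a₁b₁c₁≡R₀*4area₁ = a * b * c := R₀ * (k 4 * area)
  area₁*[t₁²+1]≡t₁b₁c₁ = area * e₁ := t₁ * (b * c)
  t₁-sign-identity = e₁ * e₂ * (b+c-a * c+a-b) := t₁ * (b * ((k 2 * e₂ * V) * (k 2 * e₂ * V)))

open import Relation.Binary.PropositionalEquality using (_≡_; refl; sym; trans; cong; cong₂; subst)
open import Data.Rational using (ℚ; _+_; _-_; _*_; -_; 0ℚ; 1ℚ; _<_; _≤_; positive; nonNegative; nonPositive)
open import Data.Rational.Properties
  using (≤-total; <⇒≤; +-mono-≤-<; +-monoˡ-<; +-inverseʳ; *-zeroˡ; *-identityʳ; positive⁻¹; nonNegative⁻¹;
         pos*pos⇒pos; nonNeg*nonNeg⇒nonNeg; nonPos*nonPos⇒nonPos; *-cancelʳ-<-nonNeg; *-cancelʳ-≤-pos)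
open import Data.Sum using (inj₁; inj₂)
open import Defs

p<q⇒0<q-p : ∀ {p q} → p < q → 0ℚ < q - p
p<q⇒0<q-p {p} {q} p<q = subst (_< q - p) (+-inverseʳ p) (+-monoˡ-< (- p) p<q)

0<p*q : ∀ {p q} → 0ℚ < p → 0ℚ < q → 0ℚ < p * q
0<p*q {p} {q} 0<p 0<q = positive⁻¹ _ {{pos*pos⇒pos p {{positive 0<p}} q {{positive 0<q}}}}

0≤p*q : ∀ {p q} → 0ℚ ≤ p → 0ℚ ≤ q → 0ℚ ≤ p * q
0≤p*q {p} {q} 0≤p 0≤q =
  nonNegative⁻¹ _ {{nonNeg*nonNeg⇒nonNeg p {{nonNegative 0≤p}} q {{nonNegative 0≤q}}}}

0≤p*p : ∀ p → 0ℚ ≤ p * p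
0≤p*p p with ≤-total 0ℚ p
... | inj₁ 0≤p = 0≤p*q 0≤p 0≤p
... | inj₂ p≤0 = nonNegative⁻¹ _ {{nonPos*nonPos⇒nonPos p {{nonPositive p≤0}} p {{nonPositive p≤0}}}}

0<p²+1 : ∀ p → 0ℚ < p ^ 2 + 1ℚ
0<p²+1 p = +-mono-≤-< (subst (0ℚ ≤_) (sym (cong (p *_) (*-identityʳ p))) (0≤p*p p)) (positive⁻¹ 1ℚ)

0<p*q⇒0<p : ∀ {p q} → 0ℚ ≤ q → 0ℚ < p * q → 0ℚ < p
0<p*q⇒0<p {p} {q} 0≤q 0<pq = *-cancelʳ-<-nonNeg q {{nonNegative 0≤q}} (subst (_< p * q) (sym (*-zeroˡ q)) 0<pq)

0≤p*q⇒0≤p : ∀ {p q} → 0ℚ < q → 0ℚ ≤ p * q → 0ℚ ≤ p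
0≤p*q⇒0≤p {p} {q} 0<q 0≤pq = *-cancelʳ-≤-pos q {{positive 0<q}} (subst (_≤ p * q) (sym (*-zeroˡ q)) 0≤pq)

heron-product : ∀ a b c {p f g h} → a + b + c ≡ p → a + b - c ≡ f → b + c - a ≡ g → c + a - b ≡ h →
                heron a b c ≡ p * f * g * h
heron-product a b c refl refl refl refl = refl

module ℚFormulas = Formulas ℚ._+_ ℚ._*_ ℚ.-_ (λ q → q)
open ℚFormulas.Parametrised using (U₁; V₁)

area₁ : ℚ → ℚ → ℚ
area₁ t₁ t₂ = k 2 * t₁ ^ 3 * t₂ ^ 3 * (t₁ + t₂) * (t₁ ^ 2 + 1ℚ) * (t₂ ^ 2 + 1ℚ) ^ 2
              * S t₁ t₂ * T t₁ t₂ * U₁ t₁ t₂ * V₁ t₁ t₂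

a₂≡a₁-swapped : ∀ t₁ t₂ → a₂ t₁ t₂ ≡ a₁ t₂ t₁
a₂≡a₁-swapped = solve 2 Equations.a₂≡a₁-swapped refl

b₂≡b₁-swapped : ∀ t₁ t₂ → b₂ t₁ t₂ ≡ b₁ t₂ t₁
b₂≡b₁-swapped = solve 2 Equations.b₂≡b₁-swapped refl

c₂≡c₁-swapped : ∀ t₁ t₂ → c₂ t₁ t₂ ≡ c₁ t₂ t₁
c₂≡c₁-swapped = solve 2 Equations.c₂≡c₁-swapped refl

R₀-comm : ∀ t₁ t₂ → R₀ t₁ t₂ ≡ R₀ t₂ t₁
R₀-comm = solve 2 Equations.R₀-comm refl

perim₀-comm : ∀ t₁ t₂ → perim₀ t₁ t₂ ≡ perim₀ t₂ t₁
perim₀-comm = solve 2 Equations.perim₀-comm refl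

perimeter₁ : ∀ t₁ t₂ → perimeter (a₁ t₁ t₂) (b₁ t₁ t₂) (c₁ t₁ t₂) ≡ perim₀ t₁ t₂
perimeter₁ = solve 2 Equations.perimeter₁ refl

a₁+b₁-c₁-factorisation : ∀ t₁ t₂ → a₁ t₁ t₂ + b₁ t₁ t₂ - c₁ t₁ t₂
                                      ≡ k 2 * t₁ * (t₂ ^ 2 + 1ℚ) * (t₁ + t₂) * T t₁ t₂ * U₁ t₁ t₂
a₁+b₁-c₁-factorisation = solve 2 Equations.a₁+b₁-c₁-factorisation refl

b₁+c₁-a₁-factorisation : ∀ t₁ t₂ → b₁ t₁ t₂ + c₁ t₁ t₂ - a₁ t₁ t₂
                                      ≡ k 2 * t₁ * (t₂ ^ 2 + 1ℚ) * U₁ t₁ t₂ * V₁ t₁ t₂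
b₁+c₁-a₁-factorisation = solve 2 Equations.b₁+c₁-a₁-factorisation refl

c₁+a₁-b₁-factorisation : ∀ t₁ t₂ → c₁ t₁ t₂ + a₁ t₁ t₂ - b₁ t₁ t₂
                                      ≡ k 4 * t₁ * t₂ ^ 3 * (t₁ ^ 2 + 1ℚ) * (t₂ ^ 2 + 1ℚ) * S t₁ t₂ * V₁ t₁ t₂
c₁+a₁-b₁-factorisation = solve 2 Equations.c₁+a₁-b₁-factorisation refl

module _ (t₁ t₂ : ℚ) where
  heron₁ : heron (a₁ t₁ t₂) (b₁ t₁ t₂) (c₁ t₁ t₂) ≡ (k 4 * area₁ t₁ t₂) * (k 4 * area₁ t₁ t₂)
  heron₁ = trans
    (heron-product (a₁ t₁ t₂) (b₁ t₁ t₂) (c₁ t₁ t₂) (perimeter₁ t₁ t₂)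
      (a₁+b₁-c₁-factorisation t₁ t₂) (b₁+c₁-a₁-factorisation t₁ t₂) (c₁+a₁-b₁-factorisation t₁ t₂))
    (solve 11 MonomialEquations.heron₁ refl
      t₁ t₂ (t₁ + t₂) (t₁ ^ 2 + 1ℚ) (t₂ ^ 2 + 1ℚ) (S t₁ t₂) (T t₁ t₂) (U₁ t₁ t₂) (V₁ t₁ t₂) (P t₁ t₂) (Q t₁ t₂))

  a₁b₁c₁≡R₀*4area₁ : a₁ t₁ t₂ * b₁ t₁ t₂ * c₁ t₁ t₂ ≡ R₀ t₁ t₂ * (k 4 * area₁ t₁ t₂)
  a₁b₁c₁≡R₀*4area₁ = solve 11 MonomialEquations.a₁b₁c₁≡R₀*4area₁ refl
    t₁ t₂ (t₁ + t₂) (t₁ ^ 2 + 1ℚ) (t₂ ^ 2 + 1ℚ) (S t₁ t₂) (T t₁ t₂) (U₁ t₁ t₂) (V₁ t₁ t₂) (P t₁ t₂) (Q t₁ t₂)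

  area₁*[t₁²+1]≡t₁b₁c₁ : area₁ t₁ t₂ * (t₁ ^ 2 + 1ℚ) ≡ t₁ * (b₁ t₁ t₂ * c₁ t₁ t₂)
  area₁*[t₁²+1]≡t₁b₁c₁ = solve 11 MonomialEquations.area₁*[t₁²+1]≡t₁b₁c₁ refl
    t₁ t₂ (t₁ + t₂) (t₁ ^ 2 + 1ℚ) (t₂ ^ 2 + 1ℚ) (S t₁ t₂) (T t₁ t₂) (U₁ t₁ t₂) (V₁ t₁ t₂) (P t₁ t₂) (Q t₁ t₂)

  t₁-sign-identity :
    (t₁ ^ 2 + 1ℚ) * (t₂ ^ 2 + 1ℚ) * ((b₁ t₁ t₂ + c₁ t₁ t₂ - a₁ t₁ t₂) * (c₁ t₁ t₂ + a₁ t₁ t₂ - b₁ t₁ t₂))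
    ≡ t₁ * (b₁ t₁ t₂ * ((k 2 * (t₂ ^ 2 + 1ℚ) * V₁ t₁ t₂) * (k 2 * (t₂ ^ 2 + 1ℚ) * V₁ t₁ t₂)))
  t₁-sign-identity = trans
    (cong₂ (λ g h → (t₁ ^ 2 + 1ℚ) * (t₂ ^ 2 + 1ℚ) * (g * h))
      (b₁+c₁-a₁-factorisation t₁ t₂) (c₁+a₁-b₁-factorisation t₁ t₂))
    (solve 11 MonomialEquations.t₁-sign-identity refl
      t₁ t₂ (t₁ + t₂) (t₁ ^ 2 + 1ℚ) (t₂ ^ 2 + 1ℚ) (S t₁ t₂) (T t₁ t₂) (U₁ t₁ t₂) (V₁ t₁ t₂) (P t₁ t₂) (Q t₁ t₂))

circumradius₁ : ∀ t₁ t₂ → IsTriangle (a₁ t₁ t₂) (b₁ t₁ t₂) (c₁ t₁ t₂) →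
                HasCircumradius (a₁ t₁ t₂) (b₁ t₁ t₂) (c₁ t₁ t₂) (R₀ t₁ t₂)
circumradius₁ t₁ t₂ (_ , 0<b , 0<c , _ , a<b+c , b<c+a) =
  area₁ t₁ t₂ , (0≤area , sym (heron₁ t₁ t₂)) , a₁b₁c₁≡R₀*4area₁ t₁ t₂
  where
  0<t₁ : 0ℚ < t₁
  0<t₁ = 0<p*q⇒0<p (0≤p*q (<⇒≤ 0<b) (0≤p*p (k 2 * (t₂ ^ 2 + 1ℚ) * V₁ t₁ t₂)))
           (subst (0ℚ <_) (t₁-sign-identity t₁ t₂)
             (0<p*q (0<p*q (0<p²+1 t₁) (0<p²+1 t₂)) (0<p*q (p<q⇒0<q-p a<b+c) (p<q⇒0<q-p b<c+a))))

  0≤area : 0ℚ ≤ area₁ t₁ t₂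
  0≤area = 0≤p*q⇒0≤p (0<p²+1 t₁)
             (subst (0ℚ ≤_) (sym (area₁*[t₁²+1]≡t₁b₁c₁ t₁ t₂)) (<⇒≤ (0<p*q 0<t₁ (0<p*q 0<b 0<c))))

transport-sides : ∀ (F : ℚ → ℚ → ℚ → Set) {a b c a′ b′ c′} → a ≡ a′ → b ≡ b′ → c ≡ c′ → F a b c → F a′ b′ c′
transport-sides F refl refl refl Fabc = Fabc

module _ (F : ℚ → ℚ → ℚ → Set) (t₁ t₂ : ℚ) where
  second⇒swapped : F (a₂ t₁ t₂) (b₂ t₁ t₂) (c₂ t₁ t₂) → F (a₁ t₂ t₁) (b₁ t₂ t₁) (c₁ t₂ t₁)
  second⇒swapped = transport-sides F (a₂≡a₁-swapped t₁ t₂) (b₂≡b₁-swapped t₁ t₂) (c₂≡c₁-swapped t₁ t₂)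

  swapped⇒second : F (a₁ t₂ t₁) (b₁ t₂ t₁) (c₁ t₂ t₁) → F (a₂ t₁ t₂) (b₂ t₁ t₂) (c₂ t₁ t₂)
  swapped⇒second =
    transport-sides F (sym (a₂≡a₁-swapped t₁ t₂)) (sym (b₂≡b₁-swapped t₁ t₂)) (sym (c₂≡c₁-swapped t₁ t₂))

circumradius₂ : ∀ t₁ t₂ → IsTriangle (a₂ t₁ t₂) (b₂ t₁ t₂) (c₂ t₁ t₂) →
                HasCircumradius (a₂ t₁ t₂) (b₂ t₁ t₂) (c₂ t₁ t₂) (R₀ t₁ t₂)
circumradius₂ t₁ t₂ triangle =
  swapped⇒second (λ a b c → HasCircumradius a b c (R₀ t₁ t₂)) t₁ t₂
    (subst (HasCircumradius (a₁ t₂ t₁) (b₁ t₂ t₁) (c₁ t₂ t₁)) (sym (R₀-comm t₁ t₂))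
      (circumradius₁ t₂ t₁ (second⇒swapped IsTriangle t₁ t₂ triangle)))

perimeter₂ : ∀ t₁ t₂ → perimeter (a₂ t₁ t₂) (b₂ t₁ t₂) (c₂ t₁ t₂) ≡ perim₀ t₁ t₂
perimeter₂ t₁ t₂ =
  swapped⇒second (λ a b c → perimeter a b c ≡ perim₀ t₁ t₂) t₁ t₂
    (trans (perimeter₁ t₂ t₁) (sym (perim₀-comm t₁ t₂)))

mainTheorem1 : (t₁ t₂ : ℚ) →
    IsTriangle (a₁ t₁ t₂) (b₁ t₁ t₂) (c₁ t₁ t₂) →
    IsTriangle (a₂ t₁ t₂) (b₂ t₁ t₂) (c₂ t₁ t₂) →
    IsRationalTriangle (a₁ t₁ t₂) (b₁ t₁ t₂) (c₁ t₁ t₂)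
    × IsRationalTriangle (a₂ t₁ t₂) (b₂ t₁ t₂) (c₂ t₁ t₂)
    × HasCircumradius (a₁ t₁ t₂) (b₁ t₁ t₂) (c₁ t₁ t₂) (R₀ t₁ t₂)
    × HasCircumradius (a₂ t₁ t₂) (b₂ t₁ t₂) (c₂ t₁ t₂) (R₀ t₁ t₂)
    × perimeter (a₁ t₁ t₂) (b₁ t₁ t₂) (c₁ t₁ t₂) ≡ perim₀ t₁ t₂
    × perimeter (a₂ t₁ t₂) (b₂ t₁ t₂) (c₂ t₁ t₂) ≡ perim₀ t₁ t₂
mainTheorem1 t₁ t₂ triangle₁ triangle₂ =
  map₂ proj₁ circumcircle₁ , map₂ proj₁ circumcircle₂ ,
  circumcircle₁ , circumcircle₂ , perimeter₁ t₁ t₂ , perimeter₂ t₁ t₂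
  where
  circumcircle₁ : HasCircumradius (a₁ t₁ t₂) (b₁ t₁ t₂) (c₁ t₁ t₂) (R₀ t₁ t₂)
  circumcircle₁ = circumradius₁ t₁ t₂ triangle₁

  circumcircle₂ : HasCircumradius (a₂ t₁ t₂) (b₂ t₁ t₂) (c₂ t₁ t₂) (R₀ t₁ t₂)
  circumcircle₂ = circumradius₂ t₁ t₂ triangle₂
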